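{- Let $L$ be a lattice data structure of height $h$. Suppose the procedure $P$ used to perform each jump step of JumpSearchLDS runs in time $O(t_P(m))$ on a sorted column or diagonal segment of $m$ elements. Then JumpSearchLDS on $L$ runs in time $O(J(L)\,t_P(h))$.
   Context: Diagram of height $h$: cells $(r,c)$ of positive integers with $r+c\le h+4$; $r$ is the row (numbered bottom to top), $c$ the column (left to right). Diagonal $k$ ($1\le k\le h+3$) is the set of cells with $r+c=k+1$, numbered from head $(k,1)$ to tail $(1,k)$, its $j$-th cell being $(k+1-j,j)$. A lattice data structure (LDS) of height $h$ assigns to each cell an entry in $\{0,\infty\}\cup\mathbb{Z}_{>0}$ such that: (1) all cells of row $1$ and column $1$ contain $0$; (2) all cells of diagonal $h+3$ except head and tail contain $\infty$; (3) for some $0\le m\le h-1$, exactly the cells $(h+3-j,j)$ of diagonal $h+2$ with $h+2-m\le j\le h+1$ contain $\infty$; (4) all remaining cells contain pairwise distinct positive integers (proper keys); (5) proper keys are strictly increasing along each row (left to right), column (bottom to top) and diagonal (head to tail). Order convention: $0<n<\infty$. For a cell $C=(r,c)$: $D=(r-1,c)$, $DR=(r-1,c+1)$. SearchLDS($L,K$) for a positive integer $K$: start at $(h+1,2)$; repeatedly: entry $=K$ → stop; entry $=0$ → stop; else move to $DR$ (a "$d$" movement) if $K>$ entry, to $D$ (a "$D$" movement) if $K<$ entry. The search path of $K$ is the sequence of movements made until termination; the jump factor $J(K;L)$ is the number of maximal blocks of consecutive identical movements in the search path (e.g. $ddddDDDDDdd$ gives $3$), and $J(L)=\max\{J(K;L):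 K \text{ a positive integer}\}$. JumpSearchLDS($L,K$): start at $C=(h+1,2)$; while the entry of $C$ is neither $K$ nor $0$: if $K<C$ (downward jump), move $C$ down its column to the first cell (going downward) whose entry is $\le K$; otherwise (diagonal jump), move $C$ along its diagonal toward the tail to the first cell whose entry is $\ge K$, setting $C$ to a cell with entry $0$ if there is no such cell. Report $K$ present if the final entry is $K$, absent otherwise. Each jump is carried out by the procedure $P$ applied to the relevant sorted part of the current column or diagonal. -}

module Defs where

open import Data.Nat using (ℕ; zero; suc; _+_; _*_; _∸_; _≤_; _<_; _<ᵇ_; _≤ᵇ_; _≡ᵇ_)
open import Data.Bool using (Bool; true; false; if_then_else_; T)
open import Data.List using (List; []; _∷_)
open import Data.Maybe using (Maybe; just; nothing)
open import Data.Product using (Σ; _×_; _,_)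
open import Data.Sum using (_⊎_)
open import Relation.Binary.PropositionalEquality using (_≡_)
open import Function.Bundles using (_⇔_)

data Entry : Set where
  zeroE : Entry
  infE  : Entry
  key   : ℕ → Entry

leB : Entry → Entry → Bool
leB zeroE   _       = true
leB (key a) (key b) = a ≤ᵇ b
leB (key _) infE    = true
leB infE    infE    = true
leB _       _       = false

_≤E_ : Entry → Entry → Set
a ≤E b = T (leB a b)

_≥E_ : Entry → Entry → Set
a ≥E b = b ≤E a

InD : ℕ → ℕ → ℕ → Set
InD h r c = (1 ≤ r) × (1 ≤ c) × (r + c ≤ h + 4)

-- Lattice data structure of height h.  Entries are given as a function on
-- all pairs (r , c); only cells of the diagram are constrained/used.
record LDS (h : ℕ) : Set where
  field
    ent : ℕ → ℕ → Entry
    row1 : ∀ c → InD h 1 c → ent 1 c ≡ zeroE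
    col1 : ∀ r → InD h r 1 → ent r 1 ≡ zeroE
    -- (2) diagonal h+3 (r + c = h + 4) except head and tail contains ∞
    diagTop : ∀ r c → 2 ≤ r → 2 ≤ c → r + c ≡ h + 4 → ent r c ≡ infE
    -- (3) on diagonal h+2 (r + c = h + 3), j-th cell = (h+3-j , j):
    --     for 2 ≤ j ≤ h+1, entry is ∞ exactly when h+2-m ≤ j
    m : ℕ
    m<h : m < h
    diagNext : ∀ r c → 2 ≤ r → 2 ≤ c → r + c ≡ h + 3 →
               (ent r c ≡ infE ⇔ (h + 2 ∸ m ≤ c))
    proper : ∀ r c → 2 ≤ r → 2 ≤ c →
             (r + c ≤ h + 2 ⊎ (r + c ≡ h + 3 × c < h + 2 ∸ m)) →
             Σ ℕ (λ n → (1 ≤ n) × (ent r c ≡ key n))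
    distinct : ∀ r c r' c' n → InD h r c → InD h r' c' →
               ent r c ≡ key n → ent r' c' ≡ key n → (r ≡ r') × (c ≡ c')
    rowInc : ∀ r c c' a b → InD h r c → InD h r c' → c < c' →
             ent r c ≡ key a → ent r c' ≡ key b → a < b
    colInc : ∀ r r' c a b → InD h r c → InD h r' c → r < r' →
             ent r c ≡ key a → ent r' c ≡ key b → a < b
    diagInc : ∀ r c r' c' a b → InD h r c → InD h r' c' → r + c ≡ r' + c' →
              c < c' → ent r c ≡ key a → ent r' c' ≡ key b → a < b

data Move : Set where
  D d : Move   -- D : down,  d : diagonal (to DR)

-- what to do at a cell with entry e when searching for K
-- (nothing = stop)
step : ℕ → Entry → Maybe Move
step K zeroE   = nothing
step K infE    = just D
step K (key n) = if n ≡ᵇ K then nothing else (if K <ᵇ n then just D else just d)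

-- search path starting at (r , c); the row strictly decreases at each
-- movement, so recursion on the row index.
searchPath : (ℕ → ℕ → Entry) → ℕ → ℕ → ℕ → List Move
searchPath ent K zero    c = []
searchPath ent K (suc r) c with step K (ent (suc r) c)
... | nothing = []
... | just D  = D ∷ searchPath ent K r c
... | just d  = d ∷ searchPath ent K r (suc c)

sameMove : Move → Move → Bool
sameMove D D = true
sameMove d d = true
sameMove _ _ = false

blocksFrom : Move → List Move → ℕ
blocksFrom x []       = 0
blocksFrom x (y ∷ ys) = if sameMove x y then blocksFrom y ys else suc (blocksFrom y ys)

blocks : List Move → ℕ
blocks []       = 0
blocks (x ∷ xs) = suc (blocksFrom x xs)

jumpFactor : ∀ {h} → LDS h → ℕ → ℕ
jumpFactor {h} L K = blocks (searchPath (LDS.ent L) K (suc h) 2)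

IsJumpFactor : ∀ {h} → LDS h → ℕ → Set
IsJumpFactor L j =
  Σ ℕ (λ K → (1 ≤ K) × (jumpFactor L K ≡ j)) ×
  (∀ K → 1 ≤ K → jumpFactor L K ≤ j)

colSeg : (ℕ → ℕ → Entry) → ℕ → ℕ → List Entry
colSeg ent c zero                = []
colSeg ent c (suc zero)          = []
colSeg ent c (suc (suc k))       = ent (suc (suc k)) c ∷ colSeg ent c (suc k)

diagSeg : (ℕ → ℕ → Entry) → ℕ → ℕ → List Entry
diagSeg ent zero          c = []
diagSeg ent (suc zero)    c = []
diagSeg ent (suc (suc k)) c = ent (suc (suc k)) c ∷ diagSeg ent (suc k) (suc c)

firstIdx : (Entry → Bool) → List Entry → Maybe ℕ
firstIdx p []       = nothing
firstIdx p (x ∷ xs) = if p x then just 0 else Data.Maybe.map suc (firstIdx p xs)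
  where import Data.Maybe

-- Total cost of JumpSearchLDS for key K, started at (r , c), with fuel f.
-- costP mv seg K : cost of procedure P performing one jump (mv = D:
-- downward jump, mv = d: diagonal jump) on the sorted segment seg.
-- Each jump costs 1 (loop overhead) plus the cost of P.
-- (Fuel h+1 is never exhausted while a jump is pending, since the row
-- decreases by at least one per jump.)
jumpCost : (ℕ → ℕ → Entry) → (Move → List Entry → ℕ → ℕ) → ℕ →
           ℕ → ℕ → ℕ → ℕ
jumpCost ent costP K zero    r c = 0
jumpCost ent costP K (suc f) r c with step K (ent r c)
... | nothing = 0
... | just D  with firstIdx (λ e → leB e (key K)) (colSeg ent c (r ∸ 1))
...   | just i  = suc (costP D (colSeg ent c (r ∸ 1)) K
                       + jumpCost ent costP K f (r ∸ 1 ∸ i) c)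
...   | nothing = suc (costP D (colSeg ent c (r ∸ 1)) K
                       + jumpCost ent costP K f 1 c)
jumpCost ent costP K (suc f) r c | just d
              with firstIdx (λ e → leB (key K) e) (diagSeg ent (r ∸ 1) (suc c))
...   | just i  = suc (costP d (diagSeg ent (r ∸ 1) (suc c)) K
                       + jumpCost ent costP K f (r ∸ 1 ∸ i) (suc c + i))
...   | nothing = suc (costP d (diagSeg ent (r ∸ 1) (suc c)) K
                       + jumpCost ent costP K f 1 (c + r ∸ 1))

jumpSearchCost : ∀ {h} → LDS h → (Move → List Entry → ℕ → ℕ) → ℕ → ℕ
jumpSearchCost {h} L costP K = jumpCost (LDS.ent L) costP K (suc h) (suc h) 2

module Submission where

open import Defs
open import Data.Bool using (Bool; true; false)
open import Data.Empty using (⊥-elim)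
open import Data.List using (List; []; _∷_; length)
open import Data.List.Relation.Unary.Linked using (Linked; []; [-]; _∷_)
open import Data.Maybe using (Maybe; just; nothing)
open import Data.Nat
open import Data.Nat.Properties
open import Data.Product using (Σ; ∃; _×_; _,_)
open import Data.Sum using (_⊎_; inj₁; inj₂)
open import Data.Unit using (tt)
open import Function.Bundles using (Equivalence)
open import Relation.Binary.PropositionalEquality
open import Relation.Nullary using (yes; no)

-- SearchLDS moves D exactly while the entry exceeds K and d exactly while
-- it is below K.  Hence a downward jump (to the first entry
-- ≤ K of the column) and a diagonal jump (to the first entry ≥ K of the
-- diagonal) each traverse precisely one maximal block of the search path
-- of K, so JumpSearchLDS makes J(K;L) ≤ J(L) jumps.  Every jump runs P on a
-- sorted segment of at most h entries, hence costs O(t_P(h)).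

<ᵇ-suc : ∀ m n → (m <ᵇ suc n) ≡ (m ≤ᵇ n)
<ᵇ-suc zero    n = refl
<ᵇ-suc (suc m) n = refl

data ColumnStep : Bool → Maybe Move → Set where
  stop  : ColumnStep true nothing
  right : ColumnStep true (just d)
  down  : ColumnStep false (just D)

data DiagonalStep : Bool → Maybe Move → Set where
  stop  : DiagonalStep true nothing
  down  : DiagonalStep true (just D)
  right : DiagonalStep false (just d)

column-step : ∀ K e → ColumnStep (leB e (key K)) (step K e)
column-step K zeroE   = stop
column-step K infE    = down
column-step K (key n) = key-step n K
  where
  key-step : ∀ n K → ColumnStep (n ≤ᵇ K) (step K (key n))
  key-step zero    zero    = stop
  key-step zero    (suc K) = right
  key-step (suc n) zero    = down
  key-step (suc n) (suc K) rewrite <ᵇ-suc n K = key-step n K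

diagonal-step : ∀ K e → e ≢ zeroE → DiagonalStep (leB (key K) e) (step K e)
diagonal-step K zeroE   e≢0 = ⊥-elim (e≢0 refl)
diagonal-step K infE    _   = down
diagonal-step K (key n) _   = key-step n K
  where
  key-step : ∀ n K → DiagonalStep (K ≤ᵇ n) (step K (key n))
  key-step zero    zero    = stop
  key-step zero    (suc K) = right
  key-step (suc n) zero    = down
  key-step (suc n) (suc K) rewrite <ᵇ-suc K n = key-step n K

length-colSeg : ∀ ent c n → length (colSeg ent c n) ≡ n ∸ 1
length-colSeg ent c zero          = refl
length-colSeg ent c (suc zero)    = refl
length-colSeg ent c (suc (suc n)) = cong suc (length-colSeg ent c (suc n))

length-diagSeg : ∀ ent n c → length (diagSeg ent n c) ≡ n ∸ 1
length-diagSeg ent zero          c = refl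
length-diagSeg ent (suc zero)    c = refl
length-diagSeg ent (suc (suc n)) c = cong suc (length-diagSeg ent (suc n) (suc c))

≤E-intro : ∀ {x y} → y ≢ zeroE → (x ≡ infE → y ≡ infE) →
           (∀ {a b} → x ≡ key a → y ≡ key b → a < b) → x ≤E y
≤E-intro {zeroE}          _   _   _   = tt
≤E-intro {infE}  {zeroE}  y≢0 _   _   = ⊥-elim (y≢0 refl)
≤E-intro {key _} {zeroE}  y≢0 _   _   = ⊥-elim (y≢0 refl)
≤E-intro {infE}  {infE}   _   _   _   = tt
≤E-intro {infE}  {key _}  _   ∞⇒∞ _   with ∞⇒∞ refl
... | ()
≤E-intro {key _} {infE}   _   _   _   = tt
≤E-intro {key a} {key b}  _   _   a<b = ≤⇒≤ᵇ (<⇒≤ (a<b refl refl))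

m∸n+[o+n]≡m+o : ∀ {m n} o → n ≤ m → m ∸ n + (o + n) ≡ m + o
m∸n+[o+n]≡m+o {m} {n} o n≤m = begin
  m ∸ n + (o + n)   ≡⟨ cong (m ∸ n +_) (+-comm o n) ⟩
  m ∸ n + (n + o)   ≡⟨ +-assoc (m ∸ n) n o ⟨
  m ∸ n + n + o     ≡⟨ cong (_+ o) (m∸n+n≡m n≤m) ⟩
  m + o             ∎
  where open ≡-Reasoning

module Jumps (ent : ℕ → ℕ → Entry) (K : ℕ) where

  -- A jump from row n + 1 scans the segment of rows n, n − 1, …, 2 and lands
  -- in row n ∸ i for the index i found, or in row 1 if there is none.  Since
  -- blocksFrom x p counts the blocks of a path p following a move x, the
  -- equations say that the jump skips exactly the block of its own move.
  SkipsDownBlock : ℕ → ℕ → Maybe ℕ → Set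
  SkipsDownBlock n c (just i) =
    i < n × blocksFrom D (searchPath ent K n c) ≡ blocks (searchPath ent K (n ∸ i) c)
  SkipsDownBlock n c nothing =
    blocksFrom D (searchPath ent K n c) ≡ blocks (searchPath ent K 1 c)

  downJump-skipsBlock : ∀ n c → ent 1 c ≡ zeroE →
    SkipsDownBlock n c (firstIdx (λ e → leB e (key K)) (colSeg ent c n))
  downJump-skipsBlock zero          c tail rewrite tail = refl
  downJump-skipsBlock (suc zero)    c tail rewrite tail = refl
  downJump-skipsBlock (suc (suc n)) c tail
    with firstIdx (λ e → leB e (key K)) (colSeg ent c (suc n))
       | downJump-skipsBlock (suc n) c tail
       | leB (ent (suc (suc n)) c) (key K) | step K (ent (suc (suc n)) c) in step≡
       | column-step K (ent (suc (suc n)) c)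
  ... | _       | _           | .true  | .nothing  | stop  rewrite step≡ = s≤s z≤n , refl
  ... | _       | _           | .true  | .(just d) | right rewrite step≡ = s≤s z≤n , refl
  ... | just i  | i<n , skips | .false | .(just D) | down  rewrite step≡ = s≤s i<n , skips
  ... | nothing | skips       | .false | .(just D) | down  rewrite step≡ = skips

  SkipsRightBlock : ℕ → ℕ → Maybe ℕ → Set
  SkipsRightBlock n c (just i) =
    i < n × blocksFrom d (searchPath ent K n c) ≡ blocks (searchPath ent K (n ∸ i) (c + i))
  SkipsRightBlock n c nothing =
    blocksFrom d (searchPath ent K n c) ≡ blocks (searchPath ent K 1 (c + n ∸ 1))

  rightJump-skipsBlock : ∀ {b} n c → 1 ≤ n → 2 ≤ c → n + c ≤ b →
    (∀ {c'} → 1 ≤ c' → 1 + c' ≤ b → ent 1 c' ≡ zeroE) →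
    (∀ {r c'} → 2 ≤ r → 2 ≤ c' → r + c' ≤ b → ent r c' ≢ zeroE) →
    SkipsRightBlock n c (firstIdx (λ e → leB (key K) e) (diagSeg ent n c))
  rightJump-skipsBlock (suc zero) c _ c≥2 le row1≡0 _
    rewrite m+n∸n≡m c 1 | row1≡0 (<⇒≤ c≥2) le = refl
  rightJump-skipsBlock (suc (suc n)) c _ c≥2 le row1≡0 inner≢0
    with firstIdx (λ e → leB (key K) e) (diagSeg ent (suc n) (suc c))
       | rightJump-skipsBlock (suc n) (suc c) (s≤s z≤n) (m≤n⇒m≤1+n c≥2)
           (≤-trans (≤-reflexive (+-suc (suc n) c)) le) row1≡0 inner≢0
       | leB (key K) (ent (suc (suc n)) c) | step K (ent (suc (suc n)) c) in step≡
       | diagonal-step K (ent (suc (suc n)) c) (inner≢0 (s≤s (s≤s z≤n)) c≥2 le)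
  ... | _       | _           | .true  | .nothing  | stop
        rewrite +-identityʳ c | step≡ = s≤s z≤n , refl
  ... | _       | _           | .true  | .(just D) | down
        rewrite +-identityʳ c | step≡ = s≤s z≤n , refl
  ... | just i  | i<n , skips | .false | .(just d) | right
        rewrite +-suc c i | step≡ = s≤s i<n , skips
  ... | nothing | skips       | .false | .(just d) | right
        rewrite +-suc c (suc n) | step≡ = skips

module Diagram {h : ℕ} (L : LDS h) where
  open LDS L

  cell : ∀ {r c} → 2 ≤ r → 2 ≤ c → r + c ≤ h + 4 → InD h r c
  cell r≥2 c≥2 le = <⇒≤ r≥2 , <⇒≤ c≥2 , le

  row1-zero : ∀ {c} → 1 ≤ c → 1 + c ≤ h + 4 → ent 1 c ≡ zeroE
  row1-zero c≥1 le = row1 _ (≤-refl , c≥1 , le)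

  diagonal-cases : ∀ {s} → s ≤ h + 4 → s ≤ h + 2 ⊎ s ≡ h + 3 ⊎ s ≡ h + 4
  diagonal-cases {s} s≤ with m≤n⇒m<n∨m≡n s≤
  ... | inj₂ top = inj₂ (inj₂ top)
  ... | inj₁ s< with m≤n⇒m<n∨m≡n (≤-pred (≤-trans s< (≤-reflexive (+-suc h 3))))
  ...   | inj₂ next = inj₂ (inj₁ next)
  ...   | inj₁ s<'  = inj₁ (≤-pred (≤-trans s<' (≤-reflexive (+-suc h 2))))

  low-key : ∀ {r c} → 2 ≤ r → 2 ≤ c → r + c ≤ h + 2 → ∃ λ n → ent r c ≡ key n
  low-key r≥2 c≥2 low with proper _ _ r≥2 c≥2 (inj₁ low)
  ... | n , _ , e = n , e

  low-not-∞ : ∀ {r c} → 2 ≤ r → 2 ≤ c → r + c ≤ h + 2 → ent r c ≢ infE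
  low-not-∞ r≥2 c≥2 low e∞ with low-key r≥2 c≥2 low
  ... | _ , ek with trans (sym e∞) ek
  ...   | ()

  interior-entry : ∀ {r c} → 2 ≤ r → 2 ≤ c → r + c ≤ h + 4 →
                   ent r c ≡ infE ⊎ ∃ λ n → ent r c ≡ key n
  interior-entry r≥2 c≥2 le with diagonal-cases le
  ... | inj₁ low        = inj₂ (low-key r≥2 c≥2 low)
  ... | inj₂ (inj₂ top) = inj₁ (diagTop _ _ r≥2 c≥2 top)
  ... | inj₂ (inj₁ next) with h + 2 ∸ m ≤? _
  ...   | yes far = inj₁ (Equivalence.from (diagNext _ _ r≥2 c≥2 next) far)
  ...   | no near with proper _ _ r≥2 c≥2 (inj₂ (next , ≰⇒> near))
  ...     | n , _ , e = inj₂ (n , e)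

  interior≢zero : ∀ {r c} → 2 ≤ r → 2 ≤ c → r + c ≤ h + 4 → ent r c ≢ zeroE
  interior≢zero r≥2 c≥2 le e0 with interior-entry r≥2 c≥2 le
  ... | inj₁ e∞      with trans (sym e0) e∞
  ...   | ()
  interior≢zero r≥2 c≥2 le e0 | inj₂ (_ , ek) with trans (sym e0) ek
  ...   | ()

  ∞-spreads-up : ∀ {a c} → 2 ≤ a → 2 ≤ c → suc a + c ≤ h + 4 →
                 ent a c ≡ infE → ent (suc a) c ≡ infE
  ∞-spreads-up a≥2 c≥2 le e∞ with diagonal-cases (≤-trans (n≤1+n _) le)
  ... | inj₁ low         = ⊥-elim (low-not-∞ a≥2 c≥2 low e∞)
  ... | inj₂ (inj₁ next) =
    diagTop _ _ (m≤n⇒m≤1+n a≥2) c≥2 (trans (cong suc next) (sym (+-suc h 3)))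
  ... | inj₂ (inj₂ top)  = ⊥-elim (<-irrefl top le)

  ∞-spreads-right : ∀ {a c} → 2 ≤ a → 2 ≤ c → suc a + c ≤ h + 4 →
                    ent (suc a) c ≡ infE → ent a (suc c) ≡ infE
  ∞-spreads-right a≥2 c≥2 le e∞ with diagonal-cases le
  ... | inj₁ low         = ⊥-elim (low-not-∞ (m≤n⇒m≤1+n a≥2) c≥2 low e∞)
  ... | inj₂ (inj₁ next) =
    Equivalence.from (diagNext _ _ a≥2 (m≤n⇒m≤1+n c≥2) (trans (+-suc _ _) next))
      (m≤n⇒m≤1+n (Equivalence.to (diagNext _ _ (m≤n⇒m≤1+n a≥2) c≥2 next) e∞))
  ... | inj₂ (inj₂ top)  = diagTop _ _ a≥2 (m≤n⇒m≤1+n c≥2) (trans (+-suc _ _) top)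

  column-ordered : ∀ {a c} → 2 ≤ a → 2 ≤ c → suc a + c ≤ h + 4 → ent a c ≤E ent (suc a) c
  column-ordered a≥2 c≥2 le =
    ≤E-intro (interior≢zero (m≤n⇒m≤1+n a≥2) c≥2 le) (∞-spreads-up a≥2 c≥2 le)
      (colInc _ _ _ _ _ (cell a≥2 c≥2 (≤-trans (n≤1+n _) le)) (cell (m≤n⇒m≤1+n a≥2) c≥2 le) ≤-refl)

  diagonal-ordered : ∀ {a c} → 2 ≤ a → 2 ≤ c → suc a + c ≤ h + 4 → ent (suc a) c ≤E ent a (suc c)
  diagonal-ordered {a} {c} a≥2 c≥2 le =
    ≤E-intro (interior≢zero a≥2 (m≤n⇒m≤1+n c≥2) le') (∞-spreads-right a≥2 c≥2 le)
      (diagInc _ _ _ _ _ _ (cell (m≤n⇒m≤1+n a≥2) c≥2 le) (cell a≥2 (m≤n⇒m≤1+n c≥2) le')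
         (sym (+-suc a c)) ≤-refl)
    where
    le' : a + suc c ≤ h + 4
    le' = ≤-trans (≤-reflexive (+-suc a c)) le

  colSeg-sorted : ∀ n c → 2 ≤ c → n + c ≤ h + 4 → Linked _≥E_ (colSeg ent c n)
  colSeg-sorted zero                c _   _  = []
  colSeg-sorted (suc zero)          c _   _  = []
  colSeg-sorted (suc (suc zero))    c _   _  = [-]
  colSeg-sorted (suc (suc (suc n))) c c≥2 le =
    column-ordered (s≤s (s≤s z≤n)) c≥2 le ∷ colSeg-sorted (suc (suc n)) c c≥2 (≤-trans (n≤1+n _) le)

  diagSeg-sorted : ∀ n c → 2 ≤ c → n + c ≤ h + 4 → Linked _≤E_ (diagSeg ent n c)
  diagSeg-sorted zero                c _   _  = []
  diagSeg-sorted (suc zero)          c _   _  = []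
  diagSeg-sorted (suc (suc zero))    c _   _  = [-]
  diagSeg-sorted (suc (suc (suc n))) c c≥2 le =
    diagonal-ordered (s≤s (s≤s z≤n)) c≥2 le ∷
    diagSeg-sorted (suc (suc n)) (suc c) (m≤n⇒m≤1+n c≥2) (≤-trans (≤-reflexive (+-suc _ c)) le)

  row-bound : ∀ {r c} → 2 ≤ c → suc (suc r) + c ≤ h + 4 → r ≤ h
  row-bound {r} c≥2 le =
    +-cancelʳ-≤ 4 r h (≤-trans (≤-reflexive r+4≡) (≤-trans (+-monoʳ-≤ _ c≥2) le))
    where
    r+4≡ : r + 4 ≡ suc (suc r) + 2
    r+4≡ = trans (+-suc r 3) (cong suc (+-suc r 2))

module JumpCost (t : ℕ → ℕ) (t-mono : ∀ {m n} → m ≤ n → t m ≤ t n)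
  (costP : Move → List Entry → ℕ → ℕ) (cP : ℕ)
  (costP-D : ∀ seg K → Linked _≥E_ seg → costP D seg K ≤ cP * t (length seg))
  (costP-d : ∀ seg K → Linked _≤E_ seg → costP d seg K ≤ cP * t (length seg))
  {h : ℕ} (L : LDS h) (K : ℕ) where
  open LDS L
  open Diagram L
  open Jumps ent K

  jumpBound : ℕ
  jumpBound = suc (cP * t h)

  segment-cost : ∀ {x} (seg : List Entry) {n} → length seg ≡ n → n ≤ h →
                 x ≤ cP * t (length seg) → x ≤ cP * t h
  segment-cost _ len≡n n≤h x≤ = ≤-trans x≤ (*-monoʳ-≤ cP (t-mono (≤-trans (≤-reflexive len≡n) n≤h)))

  downJump-cost : ∀ {r c} → 2 ≤ c → suc (suc r) + c ≤ h + 4 →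
                  costP D (colSeg ent c (suc r)) K ≤ cP * t h
  downJump-cost {r} {c} c≥2 le =
    segment-cost (colSeg ent c (suc r)) (length-colSeg ent c (suc r)) (row-bound c≥2 le)
      (costP-D _ K (colSeg-sorted (suc r) c c≥2 (≤-trans (n≤1+n _) le)))

  rightJump-cost : ∀ {r c} → 2 ≤ c → suc (suc r) + c ≤ h + 4 →
                   costP d (diagSeg ent (suc r) (suc c)) K ≤ cP * t h
  rightJump-cost {r} {c} c≥2 le =
    segment-cost (diagSeg ent (suc r) (suc c)) (length-diagSeg ent (suc r) (suc c)) (row-bound c≥2 le)
      (costP-d _ K (diagSeg-sorted (suc r) (suc c) (m≤n⇒m≤1+n c≥2)
                      (≤-trans (≤-reflexive (+-suc _ c)) le)))

  one-jump : ∀ {x y b b'} → x ≤ cP * t h → y ≤ jumpBound * b' → b ≡ b' →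
             suc (x + y) ≤ jumpBound * suc b
  one-jump {b = b} x≤ y≤ refl =
    ≤-trans (+-mono-≤ (s≤s x≤) y≤) (≤-reflexive (sym (*-suc jumpBound b)))

  cost≤blocks : ∀ f r c → 1 ≤ r → 2 ≤ c → r + c ≤ h + 4 →
                jumpCost ent costP K f r c ≤ jumpBound * blocks (searchPath ent K r c)
  cost≤blocks zero r c _ _ _ = z≤n
  cost≤blocks (suc f) (suc zero) c _ c≥2 le rewrite row1-zero (<⇒≤ c≥2) le = z≤n
  cost≤blocks (suc f) (suc (suc r)) c _ c≥2 le with step K (ent (suc (suc r)) c)
  ... | nothing = z≤n
  ... | just D
    with firstIdx (λ e → leB e (key K)) (colSeg ent c (suc r))
       | downJump-skipsBlock (suc r) c (row1-zero (<⇒≤ c≥2) (≤-trans (+-monoˡ-≤ c (s≤s z≤n)) le))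
  ...   | just i  | i<n , skips = one-jump (downJump-cost c≥2 le)
          (cost≤blocks f (suc r ∸ i) c (m<n⇒0<n∸m i<n) c≥2
             (≤-trans (+-monoˡ-≤ c (≤-trans (m∸n≤m (suc r) i) (n≤1+n _))) le)) skips
  ...   | nothing | skips = one-jump (downJump-cost c≥2 le)
          (cost≤blocks f 1 c (s≤s z≤n) c≥2 (≤-trans (+-monoˡ-≤ c (s≤s z≤n)) le)) skips
  cost≤blocks (suc f) (suc (suc r)) c _ c≥2 le | just d
    with firstIdx (λ e → leB (key K) e) (diagSeg ent (suc r) (suc c))
       | rightJump-skipsBlock (suc r) (suc c) (s≤s z≤n) (m≤n⇒m≤1+n c≥2)
           (≤-trans (≤-reflexive (+-suc (suc r) c)) le) row1-zero interior≢zero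
  ...   | just i  | i<n , skips = one-jump (rightJump-cost c≥2 le)
          (cost≤blocks f (suc r ∸ i) (suc c + i) (m<n⇒0<n∸m i<n)
             (≤-trans (m≤n⇒m≤1+n c≥2) (m≤m+n _ i))
             (≤-trans (≤-reflexive (trans (m∸n+[o+n]≡m+o (suc c) (<⇒≤ i<n)) (+-suc (suc r) c))) le))
          skips
  ...   | nothing | skips rewrite +-suc c (suc r) = one-jump (rightJump-cost c≥2 le)
          (cost≤blocks f 1 (c + suc r) (s≤s z≤n) (≤-trans c≥2 (m≤m+n c _))
             (≤-trans (≤-reflexive (cong suc (+-comm c (suc r)))) le))
          skips

theorem3 : (t : ℕ → ℕ) → (∀ {m n} → m ≤ n → t m ≤ t n) → (∀ m → 1 ≤ t m) →
           (costP : Move → List Entry → ℕ → ℕ) → (cP : ℕ) →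
           (∀ seg K → Linked _≥E_ seg → costP D seg K ≤ cP * t (length seg)) →
           (∀ seg K → Linked _≤E_ seg → costP d seg K ≤ cP * t (length seg)) →
           Σ ℕ (λ c → ∀ h (L : LDS h) (K j : ℕ) → 1 ≤ K → IsJumpFactor L j →
             jumpSearchCost L costP K ≤ c * (j * t h))
theorem3 t t-mono t≥1 costP cP costP-D costP-d = suc cP , bound
  where
  bound : ∀ h (L : LDS h) (K j : ℕ) → 1 ≤ K → IsJumpFactor L j →
          jumpSearchCost L costP K ≤ suc cP * (j * t h)
  bound h L K j K≥1 (_ , J-max) = begin
    jumpSearchCost L costP K   ≤⟨ cost≤blocks (suc h) (suc h) 2 (s≤s z≤n) ≤-refl initial-cell ⟩
    jumpBound * jumpFactor L K ≤⟨ *-monoʳ-≤ jumpBound (J-max K K≥1) ⟩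
    jumpBound * j              ≤⟨ *-monoˡ-≤ j (+-monoˡ-≤ (cP * t h) (t≥1 h)) ⟩
    suc cP * t h * j           ≡⟨ *-assoc (suc cP) (t h) j ⟩
    suc cP * (t h * j)         ≡⟨ cong (suc cP *_) (*-comm (t h) j) ⟩
    suc cP * (j * t h)         ∎
    where
    open JumpCost t t-mono costP cP costP-D costP-d L K
    open ≤-Reasoning
    initial-cell : suc h + 2 ≤ h + 4
    initial-cell = ≤-trans (≤-reflexive (sym (+-suc h 2))) (+-monoʳ-≤ h (n≤1+n 3))
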